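{- Let $n\ge 4$ be even, let $m=n-2$, and let $A=A_\mu^{(n)}=(a_{i,j})$ be the fundamental harmonic matrix of order $n$. Define the $m\times m$ matrix $H=\mathcal{R}_\mu(A)$ by $H_{i,j}=a_{i,j}$ if $i+j\le m+1$ and $H_{i,j}=a_{i+2,j+2}$ if $i+j\ge m+2$ (for $1\le i,j\le m$). Then $H$ is a harmonic matrix of order $m$, and $H\cong A_\mu^{(n-2)}$.
   Context: Let $[n]=\{1,\dots,n\}$. A matrix $M=(m_{i,j})\in[n]^{n\times n}$ is harmonic if each row is a permutation of $[n]$ and the collection of horizontally adjacent pairs $(m_{i,j},m_{i,j+1})$ ($1\le i\le n$, $1\le j\le n-1$) contains each ordered pair $(a,b)$ with $a\ne b$ exactly once. Two $n\times n$ harmonic matrices $M,N$ are isomorphic, $M\cong N$, if there exist permutations $\sigma,\tau$ of $[n]$ with $N_{\tau(i),j}=\sigma(m_{i,j})$ for all $i,j$ (relabeling of symbols plus reordering of rows). For even $n\ge2$, let $f$ be the permutation of $[n]$ given by $f(1)=2$, $f(n)=n-1$, and for $1<i<n$: $f(i)=i+2$ if $i$ is even and $f(i)=i-2$ if $i$ is odd. The fundamental harmonic matrix $A_\mu^{(n)}$ is the $n\times n$ matrix whose $k$-th row is $(f^{e_k}(1),f^{e_k}(2),\dots,f^{e_k}(n))$, where $e_1=0$, $e_{2t}=t$ and $e_{2t+1}=-t$ (negative exponents meaning powers of $f^{ -1}$), for $k=1,\dots,n$. For example $A_\mu^{(2)}$ has rows $(1,2),(2,1)$ and $A_\mu^{(4)}$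 has rows $(1,2,3,4),(2,4,1,3),(3,1,4,2),(4,3,2,1)$. The operator $\mathcal{R}_\mu$ corresponds to deleting the band of entries $(i,j)$ with $|i+j-(n+1)|\le 1$ and merging the remaining upper-left triangle and lower-right triangle along the secondary diagonal. -}

module Defs where

open import Data.Nat using (ℕ; zero; suc; _+_; _∸_; _≤_; _/_; _%_; _≡ᵇ_; _≤ᵇ_)
open import Data.Bool using (if_then_else_)
open import Data.Product using (_×_; ∃; ∃-syntax; _,_)
open import Relation.Binary.PropositionalEquality using (_≡_; _≢_)

-- Matrices are 1-indexed functions ℕ → ℕ → ℕ; only entries with indices in [n] matter.
Matrix : Set
Matrix = ℕ → ℕ → ℕ

InRange : ℕ → ℕ → Set
InRange n x = 1 ≤ x × x ≤ n

IsPermOn : ℕ → (ℕ → ℕ) → Set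
IsPermOn n g =
  (∀ x → InRange n x → InRange n (g x)) ×
  (∀ x y → InRange n x → InRange n y → g x ≡ g y → x ≡ y) ×
  (∀ y → InRange n y → ∃[ x ] (InRange n x × g x ≡ y))

PairAt : ℕ → Matrix → ℕ → ℕ → ℕ → ℕ → Set
PairAt n M a b i j = InRange n i × InRange (n ∸ 1) j × M i j ≡ a × M i (suc j) ≡ b

Harmonic : ℕ → Matrix → Set
Harmonic n M =
  (∀ i → InRange n i → IsPermOn n (M i)) ×
  (∀ a b → InRange n a → InRange n b → a ≢ b →
     (∃[ i ] ∃[ j ] PairAt n M a b i j) ×
     (∀ i j i' j' → PairAt n M a b i j → PairAt n M a b i' j' → i ≡ i' × j ≡ j'))

Isomorphic : ℕ → Matrix → Matrix → Set
Isomorphic n M N = ∃[ σ ] ∃[ τ ]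
  (IsPermOn n σ × IsPermOn n τ ×
   (∀ i j → InRange n i → InRange n j → N (τ i) j ≡ σ (M i j)))

fμ : ℕ → ℕ → ℕ
fμ n i =
  if i ≡ᵇ 1 then 2
  else if i ≡ᵇ n then n ∸ 1
  else if i % 2 ≡ᵇ 0 then i + 2
  else i ∸ 2

search : (ℕ → ℕ) → ℕ → ℕ → ℕ
search g x zero = zero
search g x (suc k) = if g (suc k) ≡ᵇ x then suc k else search g x k

fμ⁻¹ : ℕ → ℕ → ℕ
fμ⁻¹ n x = search (fμ n) x n

iter : (ℕ → ℕ) → ℕ → ℕ → ℕ
iter g zero x = x
iter g (suc t) x = g (iter g t x)

-- fundamental harmonic matrix A_μ^{(n)}: row k is f^{e_k}, e_1 = 0, e_{2t} = t, e_{2t+1} = -t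
Aμ : ℕ → Matrix
Aμ n k j = if k % 2 ≡ᵇ 0 then iter (fμ n) (k / 2) j else iter (fμ⁻¹ n) (k / 2) j

Rμ : ℕ → Matrix
Rμ n i j = if i + j ≤ᵇ (n ∸ 2) + 1 then Aμ n i j else Aμ n (i + 2) (j + 2)

module Submission where

open import Defs
open import Data.Nat
  using (ℕ; zero; suc; _+_; _*_; _∸_; _≤_; _<_; _%_; _/_; _≡ᵇ_; _≤ᵇ_; z≤n; s≤s; NonZero; >-nonZero)
open import Data.Nat.Divisibility using (_∣_)
import Data.Nat.Divisibility as ℕ
import Data.Nat.Properties as ℕ
import Data.Nat.DivMod as ℕ
import Data.Nat.Tactic.RingSolver as ℕ-Solver
open import Data.Integer using (ℤ; +_; +[1+_]; -[1+_]; 0ℤ; ∣_∣; -_)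
  renaming (_+_ to _+ℤ_; _-_ to _-ℤ_; _*_ to _*ℤ_)
open import Data.Integer.DivMod using (_%ℕ_; _/ℕ_; n%ℕd<d; a≡a%ℕn+[a/ℕn]*n)
import Data.Integer.Properties as ℤ
open import Data.Integer.Divisibility.Signed as ℤ∣ using (divides)
open import Data.Integer.Tactic.RingSolver using (solve; solve-∀)
open import Data.List using (_∷_; [])
open import Data.Bool using (true; false; T; if_then_else_)
open import Data.Product using (_×_; _,_; proj₁; proj₂; map₂; ∃-syntax)
open import Function using (_∘_; id)
open import Relation.Nullary using (¬_; Dec; yes; no; contradiction)
open import Relation.Binary using (Setoid)
open import Relation.Binary.PropositionalEquality

-- Label row k of A_μ by its exponent e_k (e_{2t} = t, e_{2t+1} = -t). On [n], n = 2h, the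
-- labels run once through the window -h < z ≤ h of representatives of ℤ/n, and f adds 1 to
-- labels modulo n. Hence the entry of A_μ in row k and column j is the element labelled
-- e_k + e_j: A_μ is the addition table of ℤ/n read through e. The successive differences
-- e_{j+1} - e_j = ±j run through all nonzero residues, i.e. e is a directed terrace, and the
-- addition table of a directed terrace is harmonic. In R_μ(A_μ) an upper-left entry keeps the
-- label e_i + e_j, which already lies in the window of ℤ/(n-2). A lower-right entry has label
-- e_{i+2} + e_{j+2} = e_i + e_j + c with c ∈ {2, 0, -2} according to the parities of i and j;
-- its representative modulo n is e_i + e_j - c(n-2)/2, which again lies in the window of
-- ℤ/(n-2) and is congruent to e_i + e_j modulo n - 2. So R_μ(A_μ^{(n)}) is the addition table
-- of ℤ/(n-2) through the same labelling, i.e. it equals A_μ^{(n-2)}.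

-- Congruence modulo n

infix 4 _≡_[mod_]

record _≡_[mod_] (x y : ℤ) (n : ℕ) : Set where
  constructor congruence
  field
    divides-difference : + n ℤ∣.∣ x -ℤ y

module _ {n : ℕ} where

  private
    via : ∀ {x y d} → + n ℤ∣.∣ d → d ≡ x -ℤ y → x ≡ y [mod n ]
    via p refl = congruence p

  mod-reflexive : ∀ {x y} → x ≡ y → x ≡ y [mod n ]
  mod-reflexive {x} refl = via (divides 0ℤ (sym (ℤ.*-zeroˡ (+ n)))) (sym (ℤ.+-inverseʳ x))

  mod-refl : ∀ {x} → x ≡ x [mod n ]
  mod-refl = mod-reflexive refl

  mod-sym : ∀ {x y} → x ≡ y [mod n ] → y ≡ x [mod n ]
  mod-sym {x} {y} (congruence p) = via (ℤ∣.∣m⇒∣-m p) (solve (x ∷ y ∷ []))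

  mod-trans : ∀ {x y z} → x ≡ y [mod n ] → y ≡ z [mod n ] → x ≡ z [mod n ]
  mod-trans {x} {y} {z} (congruence p) (congruence q) =
    via (ℤ∣.∣m∣n⇒∣m+n p q) (solve (x ∷ y ∷ z ∷ []))

  mod-+-cong : ∀ {x y u v} → x ≡ y [mod n ] → u ≡ v [mod n ] → x +ℤ u ≡ y +ℤ v [mod n ]
  mod-+-cong {x} {y} {u} {v} (congruence p) (congruence q) =
    via (ℤ∣.∣m∣n⇒∣m+n p q) (solve (x ∷ y ∷ u ∷ v ∷ []))

  mod-neg-cong : ∀ {x y} → x ≡ y [mod n ] → - x ≡ - y [mod n ]
  mod-neg-cong {x} {y} (congruence p) = via (ℤ∣.∣m⇒∣-m p) (solve (x ∷ y ∷ []))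

  mod---cong : ∀ {x y u v} → x ≡ y [mod n ] → u ≡ v [mod n ] → x -ℤ u ≡ y -ℤ v [mod n ]
  mod---cong p q = mod-+-cong p (mod-neg-cong q)

  mod-+-cancelˡ : ∀ k {x y} → k +ℤ x ≡ k +ℤ y [mod n ] → x ≡ y [mod n ]
  mod-+-cancelˡ k {x} {y} (congruence p) = via p (solve (k ∷ x ∷ y ∷ []))

  mod-by-multiple : ∀ {z x} q → z ≡ x +ℤ q *ℤ + n → z ≡ x [mod n ]
  mod-by-multiple {x = x} q refl = via (divides q refl) (sym (cancel x q (+ n)))
    where
    cancel : ∀ x q k → x +ℤ q *ℤ k -ℤ x ≡ q *ℤ k
    cancel = solve-∀

  mod-complement : ∀ {j r} → j + r ≡ n → - + j ≡ + r [mod n ]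
  mod-complement {j} {r} j+r≡n =
    mod-by-multiple (- + 1) (trans (regroup (+ j) (+ r)) (cong (λ k → + r +ℤ - + 1 *ℤ + k) j+r≡n))
    where
    regroup : ∀ a b → - a ≡ b +ℤ - + 1 *ℤ (a +ℤ b)
    regroup = solve-∀

  mod-%ℕ : ∀ z .{{_ : NonZero n}} → z ≡ + (z %ℕ n) [mod n ]
  mod-%ℕ z = via (divides (z /ℕ n) refl) (sym (subtract (a≡a%ℕn+[a/ℕn]*n z n)))
    where
    subtract : ∀ {z r k} → z ≡ r +ℤ k → z -ℤ r ≡ k
    subtract {r = r} {k} refl = solve (r ∷ k ∷ [])

  mod-unique : ∀ {u v} → u < n → v < n → + u ≡ + v [mod n ] → u ≡ v
  mod-unique {u} {v} u<n v<n (congruence p) =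
    ℤ.+-injective (ℤ.i-j≡0⇒i≡j (+ u) (+ v) (ℤ.∣i∣≡0⇒i≡0 ∣u-v∣≡0))
    where
    instance
      _ : NonZero n
      _ = >-nonZero (ℕ.≤-<-trans z≤n u<n)
    ∣u-v∣<n : ∣ + u -ℤ + v ∣ < n
    ∣u-v∣<n = subst (_< n) (cong ∣_∣ (sym (ℤ.m-n≡m⊖n u v)))
                (ℕ.≤-<-trans (ℤ.∣m⊝n∣≤m⊔n u v) (ℕ.⊔-lub u<n v<n))
    ∣u-v∣≡0 : ∣ + u -ℤ + v ∣ ≡ 0
    ∣u-v∣≡0 = trans (sym (ℕ.m<n⇒m%n≡m ∣u-v∣<n)) (ℕ.n∣m⇒m%n≡0 _ n (ℤ∣.∣⇒∣ᵤ p))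

mod-setoid : ℕ → Setoid _ _
mod-setoid n = record
  { Carrier = ℤ
  ; _≈_ = _≡_[mod n ]
  ; isEquivalence = record { refl = mod-refl ; sym = mod-sym ; trans = mod-trans }
  }

i-j+j≡i : ∀ a b → a -ℤ b +ℤ b ≡ a
i-j+j≡i = solve-∀

i+j-j≡i : ∀ a b → a +ℤ b -ℤ b ≡ a
i+j-j≡i = solve-∀

-- Addition tables of directed terraces

Δ : (ℕ → ℤ) → ℕ → ℤ
Δ ℓ j = ℓ (suc j) -ℤ ℓ j

record IsDirectedTerrace (n : ℕ) (ℓ : ℕ → ℤ) : Set where
  field
    injective : ∀ {v w} → InRange n v → InRange n w → ℓ v ≡ ℓ w [mod n ] → v ≡ w
    surjective : ∀ z → ∃[ v ] InRange n v × ℓ v ≡ z [mod n ]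
    Δ-injective : ∀ {j k} → InRange (n ∸ 1) j → InRange (n ∸ 1) k →
                  Δ ℓ j ≡ Δ ℓ k [mod n ] → j ≡ k
    Δ-surjective : ∀ z → ¬ z ≡ 0ℤ [mod n ] → ∃[ j ] InRange (n ∸ 1) j × Δ ℓ j ≡ z [mod n ]

IsAdditionTable : ℕ → (ℕ → ℤ) → Matrix → Set
IsAdditionTable n ℓ M =
  ∀ {i j} → InRange n i → InRange n j → InRange n (M i j) × ℓ (M i j) ≡ ℓ i +ℤ ℓ j [mod n ]

∈[n∸1]⇒∈[n] : ∀ {n j} → InRange (n ∸ 1) j → InRange n j
∈[n∸1]⇒∈[n] {zero} (1≤j , j≤0) = contradiction (ℕ.≤-trans 1≤j j≤0) λ ()
∈[n∸1]⇒∈[n] {suc n} (1≤j , j≤n) = 1≤j , ℕ.m≤n⇒m≤1+n j≤n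

∈[n∸1]⇒suc∈[n] : ∀ {n j} → InRange (n ∸ 1) j → InRange n (suc j)
∈[n∸1]⇒suc∈[n] {zero} (1≤j , j≤0) = contradiction (ℕ.≤-trans 1≤j j≤0) λ ()
∈[n∸1]⇒suc∈[n] {suc n} (1≤j , j≤n) = s≤s z≤n , s≤s j≤n

module _ {n ℓ M} (terrace : IsDirectedTerrace n ℓ) (table : IsAdditionTable n ℓ M) where
  open IsDirectedTerrace terrace
  open import Relation.Binary.Reasoning.Setoid (mod-setoid n)

  private
    entry-label : ∀ {i j c} → InRange n i → InRange n j → M i j ≡ c → ℓ i +ℤ ℓ j ≡ ℓ c [mod n ]
    entry-label i∈ j∈ Mij≡c = mod-trans (mod-sym (proj₂ (table i∈ j∈))) (mod-reflexive (cong ℓ Mij≡c))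

    entry-by-label : ∀ {i j c} → InRange n i → InRange n j → InRange n c →
                     ℓ i +ℤ ℓ j ≡ ℓ c [mod n ] → M i j ≡ c
    entry-by-label i∈ j∈ c∈ p =
      injective (proj₁ (table i∈ j∈)) c∈ (mod-trans (proj₂ (table i∈ j∈)) p)

    i+[j-i]≡j : ∀ a b → a +ℤ (b -ℤ a) ≡ b
    i+[j-i]≡j = solve-∀

    [i+k]-[i+j]≡k-j : ∀ a b c → a +ℤ c -ℤ (a +ℤ b) ≡ c -ℤ b
    [i+k]-[i+j]≡k-j = solve-∀

    i+k≡i+j+[k-j] : ∀ a b c → a +ℤ c ≡ a +ℤ b +ℤ (c -ℤ b)
    i+k≡i+j+[k-j] = solve-∀

  additionTable-row : ∀ {i} → InRange n i → IsPermOn n (M i)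
  additionTable-row {i} i∈ = (λ x x∈ → proj₁ (table i∈ x∈)) , row-injective , row-surjective
    where
    row-injective : ∀ x y → InRange n x → InRange n y → M i x ≡ M i y → x ≡ y
    row-injective x y x∈ y∈ Mix≡Miy =
      injective x∈ y∈
        (mod-+-cancelˡ (ℓ i) (mod-trans (entry-label i∈ x∈ Mix≡Miy) (proj₂ (table i∈ y∈))))
    row-surjective : ∀ y → InRange n y → ∃[ x ] InRange n x × M i x ≡ y
    row-surjective y y∈ with surjective (ℓ y -ℤ ℓ i)
    ... | x , x∈ , ℓx≡ℓy-ℓi = x , x∈ , entry-by-label i∈ x∈ y∈ (begin
      ℓ i +ℤ ℓ x           ≈⟨ mod-+-cong (mod-refl {x = ℓ i}) ℓx≡ℓy-ℓi ⟩
      ℓ i +ℤ (ℓ y -ℤ ℓ i)  ≡⟨ i+[j-i]≡j (ℓ i) (ℓ y) ⟩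
      ℓ y                  ∎)

  additionTable-pair : ∀ a b → InRange n a → InRange n b → a ≢ b → ∃[ i ] ∃[ j ] PairAt n M a b i j
  additionTable-pair a b a∈ b∈ a≢b = i , j , i∈ , j∈ , Mij≡a , Mij+1≡b
    where
    ℓb-ℓa≢0 : ¬ ℓ b -ℤ ℓ a ≡ 0ℤ [mod n ]
    ℓb-ℓa≢0 p = a≢b (sym (injective b∈ a∈
      (subst₂ _≡_[mod n ] (i-j+j≡i (ℓ b) (ℓ a)) (ℤ.+-identityˡ (ℓ a))
                          (mod-+-cong p (mod-refl {x = ℓ a})))))
    step = Δ-surjective (ℓ b -ℤ ℓ a) ℓb-ℓa≢0
    j = proj₁ step
    j∈ = proj₁ (proj₂ step)
    row = surjective (ℓ a -ℤ ℓ j)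
    i = proj₁ row
    i∈ = proj₁ (proj₂ row)
    ℓi+ℓj≡ℓa : ℓ i +ℤ ℓ j ≡ ℓ a [mod n ]
    ℓi+ℓj≡ℓa = begin
      ℓ i +ℤ ℓ j           ≈⟨ mod-+-cong (proj₂ (proj₂ row)) (mod-refl {x = ℓ j}) ⟩
      ℓ a -ℤ ℓ j +ℤ ℓ j    ≡⟨ i-j+j≡i (ℓ a) (ℓ j) ⟩
      ℓ a                  ∎
    Mij≡a : M i j ≡ a
    Mij≡a = entry-by-label i∈ (∈[n∸1]⇒∈[n] j∈) a∈ ℓi+ℓj≡ℓa
    Mij+1≡b : M i (suc j) ≡ b
    Mij+1≡b = entry-by-label i∈ (∈[n∸1]⇒suc∈[n] j∈) b∈ (begin
      ℓ i +ℤ ℓ (suc j)          ≡⟨ i+k≡i+j+[k-j] (ℓ i) (ℓ j) (ℓ (suc j)) ⟩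
      ℓ i +ℤ ℓ j +ℤ Δ ℓ j       ≈⟨ mod-+-cong ℓi+ℓj≡ℓa (proj₂ (proj₂ step)) ⟩
      ℓ a +ℤ (ℓ b -ℤ ℓ a)       ≡⟨ i+[j-i]≡j (ℓ a) (ℓ b) ⟩
      ℓ b                       ∎)

  additionTable-pair-unique : ∀ {a b i j i′ j′} → PairAt n M a b i j → PairAt n M a b i′ j′ →
                              i ≡ i′ × j ≡ j′
  additionTable-pair-unique {i = i} {j} {i′} {j′}
    (i∈ , j∈ , Mij≡a , Mij+1≡b) (i′∈ , j′∈ , Mi′j′≡a , Mi′j′+1≡b) = i≡i′ , j≡j′
    where
    at-j : ℓ i +ℤ ℓ j ≡ ℓ i′ +ℤ ℓ j′ [mod n ]
    at-j = mod-trans (entry-label i∈ (∈[n∸1]⇒∈[n] j∈) Mij≡a)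
                     (mod-sym (entry-label i′∈ (∈[n∸1]⇒∈[n] j′∈) Mi′j′≡a))
    at-j+1 : ℓ i +ℤ ℓ (suc j) ≡ ℓ i′ +ℤ ℓ (suc j′) [mod n ]
    at-j+1 = mod-trans (entry-label i∈ (∈[n∸1]⇒suc∈[n] j∈) Mij+1≡b)
                       (mod-sym (entry-label i′∈ (∈[n∸1]⇒suc∈[n] j′∈) Mi′j′+1≡b))
    j≡j′ : j ≡ j′
    j≡j′ = Δ-injective j∈ j′∈
      (subst₂ _≡_[mod n ] ([i+k]-[i+j]≡k-j (ℓ i) (ℓ j) (ℓ (suc j)))
                          ([i+k]-[i+j]≡k-j (ℓ i′) (ℓ j′) (ℓ (suc j′)))
                          (mod---cong at-j+1 at-j))
    i≡i′ : i ≡ i′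
    i≡i′ = injective i∈ i′∈
      (subst₂ _≡_[mod n ] (i+j-j≡i (ℓ i) (ℓ j)) (i+j-j≡i (ℓ i′) (ℓ j′))
                          (mod---cong at-j (mod-reflexive (cong ℓ j≡j′))))

  additionTable-harmonic : Harmonic n M
  additionTable-harmonic = (λ _ → additionTable-row) , λ a b a∈ b∈ a≢b →
    additionTable-pair a b a∈ b∈ a≢b , λ _ _ _ _ → additionTable-pair-unique

additionTables-agree : ∀ {n ℓ M M′} → IsDirectedTerrace n ℓ →
                       IsAdditionTable n ℓ M → IsAdditionTable n ℓ M′ →
                       ∀ {i j} → InRange n i → InRange n j → M i j ≡ M′ i j
additionTables-agree terrace table table′ i∈ j∈ =
  IsDirectedTerrace.injective terrace (proj₁ (table i∈ j∈)) (proj₁ (table′ i∈ j∈))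
    (mod-trans (proj₂ (table i∈ j∈)) (mod-sym (proj₂ (table′ i∈ j∈))))

id-isPermOn : ∀ n → IsPermOn n id
id-isPermOn n = (λ _ x∈ → x∈) , (λ _ _ _ _ x≡y → x≡y) , λ y y∈ → y , y∈ , refl

agreeing-isomorphic : ∀ {n M M′} → (∀ {i j} → InRange n i → InRange n j → M′ i j ≡ M i j) →
                      Isomorphic n M M′
agreeing-isomorphic agree = id , id , id-isPermOn _ , id-isPermOn _ , λ _ _ i∈ j∈ → agree i∈ j∈

data Parity : ℕ → Set where
  even : ∀ s → Parity (s + s)
  odd  : ∀ s → Parity (suc (s + s))

parity : ∀ k → Parity k
parity zero = even 0
parity (suc k) with parity k
... | even s = odd s
... | odd s = subst Parity (cong suc (ℕ.+-suc s s)) (even (suc s))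

even≢odd : ∀ s t → s + s ≢ suc (t + t)
even≢odd (suc s) zero eq = ℕ.1+n≢0 (trans (sym (ℕ.+-suc s s)) (ℕ.suc-injective eq))
even≢odd (suc s) (suc t) eq =
  even≢odd s t
    (ℕ.suc-injective (subst₂ _≡_ (ℕ.+-suc s s) (cong suc (ℕ.+-suc t t)) (ℕ.suc-injective eq)))

double-cancel-≤ : ∀ {s t} → s + s ≤ t + t → s ≤ t
double-cancel-≤ p = ℕ.≮⇒≥ λ t<s → ℕ.<⇒≱ (ℕ.+-mono-< t<s t<s) p

odd-double-cancel-< : ∀ {s t} → suc (s + s) ≤ t + t → s < t
odd-double-cancel-< p = ℕ.≰⇒> λ t≤s → ℕ.<⇒≱ (s≤s (ℕ.+-mono-≤ t≤s t≤s)) p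

double-odd-cancel-≤ : ∀ {s t} → s + s ≤ suc (t + t) → s ≤ t
double-odd-cancel-≤ {s} {t} p = ℕ.≮⇒≥ λ t<s →
  ℕ.<⇒≱ (subst (_≤ s + s) (cong suc (ℕ.+-suc t t)) (ℕ.+-mono-≤ t<s t<s)) p

double≡*2 : ∀ s → s + s ≡ s * 2
double≡*2 s = trans (cong (λ x → s + x) (sym (ℕ.+-identityʳ s))) (ℕ.*-comm 2 s)

double+2 : ∀ s → s + s + 2 ≡ suc s + suc s
double+2 s = trans (ℕ.+-comm (s + s) 2) (cong suc (sym (ℕ.+-suc s s)))

double%2≡0 : ∀ s → (s + s) % 2 ≡ 0
double%2≡0 s = trans (cong (_% 2) (double≡*2 s)) (ℕ.m*n%n≡0 s 2)

odd%2≡1 : ∀ s → suc (s + s) % 2 ≡ 1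
odd%2≡1 s = trans (cong (λ x → suc x % 2) (double≡*2 s)) (ℕ.[m+kn]%n≡m%n 1 s 2)

interchange : ∀ s t → s + s + (t + t) ≡ (s + t) + (s + t)
interchange = ℕ-Solver.solve-∀

interchange-odd : ∀ s t → suc (s + s) + suc (t + t) ≡ suc (suc ((s + t) + (s + t)))
interchange-odd = ℕ-Solver.solve-∀

-- The even moduli, indexed by g so that they are visibly nonzero.
2[1+_] : ℕ → ℕ
2[1+ g ] = suc g + suc g

-- The ring solver does not unfold 2[1+_], hence the auxiliary restatements.
2[1+g]+2≡2[2+g] : ∀ g → 2[1+ g ] + 2 ≡ 2[1+ suc g ]
2[1+g]+2≡2[2+g] g = lemma g
  where
  lemma : ∀ g → suc g + suc g + 2 ≡ suc (suc g) + suc (suc g)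
  lemma = ℕ-Solver.solve-∀

2[2+g]∸2+1≡2[1+g]+1 : ∀ g → 2[1+ suc g ] ∸ 2 + 1 ≡ suc 2[1+ g ]
2[2+g]∸2+1≡2[1+g]+1 g = lemma g
  where
  lemma : ∀ g → g + suc (suc g) + 1 ≡ suc (suc g + suc g)
  lemma = ℕ-Solver.solve-∀

-- Spelled exactly as in the definition of Aμ, so that case analysis on k % 2 ≡ᵇ 0 unfolds both.
e : ℕ → ℤ
e k = if k % 2 ≡ᵇ 0 then + (k / 2) else - + (k / 2)

e-by-division : ∀ k {q r} → k / 2 ≡ q → k % 2 ≡ r → e k ≡ (if r ≡ᵇ 0 then + q else - + q)
e-by-division k refl refl = refl

e-even : ∀ s → e (s + s) ≡ + s
e-even s = trans (cong e (double≡*2 s)) (e-by-division (s * 2) (ℕ.m*n/n≡m s 2) (ℕ.m*n%n≡0 s 2))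

e-odd : ∀ s → e (suc (s + s)) ≡ - + s
e-odd s = trans (cong (e ∘ suc) (double≡*2 s)) (e-by-division (1 + s * 2) quotient (ℕ.[m+kn]%n≡m%n 1 s 2))
  where
  quotient : (1 + s * 2) / 2 ≡ s
  quotient = trans (ℕ.+-distrib-/ 1 (s * 2) (subst (λ r → 1 + r < 2) (sym (ℕ.m*n%n≡0 s 2)) ℕ.≤-refl))
                   (ℕ.m*n/n≡m s 2)

e⁻¹ : ℤ → ℕ
e⁻¹ (+ zero) = 1
e⁻¹ +[1+ s ] = suc s + suc s
e⁻¹ -[1+ s ] = suc (suc s + suc s)

e∘e⁻¹ : ∀ z → e (e⁻¹ z) ≡ z
e∘e⁻¹ (+ zero) = refl
e∘e⁻¹ +[1+ s ] = e-even (suc s)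
e∘e⁻¹ -[1+ s ] = e-odd (suc s)

e⁻¹∘e : ∀ {v} → 1 ≤ v → e⁻¹ (e v) ≡ v
e⁻¹∘e {v} 1≤v with parity v
... | even zero = contradiction 1≤v λ ()
... | even (suc s) rewrite e-even (suc s) = refl
... | odd zero = refl
... | odd (suc s) rewrite e-odd (suc s) = refl

1≤e⁻¹ : ∀ z → 1 ≤ e⁻¹ z
1≤e⁻¹ (+ zero) = s≤s z≤n
1≤e⁻¹ +[1+ s ] = s≤s z≤n
1≤e⁻¹ -[1+ s ] = s≤s z≤n

e-injective : ∀ {v w} → 1 ≤ v → 1 ≤ w → e v ≡ e w → v ≡ w
e-injective 1≤v 1≤w eq = trans (sym (e⁻¹∘e 1≤v)) (trans (cong e⁻¹ eq) (e⁻¹∘e 1≤w))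

e-even+2 : ∀ s → e (s + s + 2) ≡ + 1 +ℤ + s
e-even+2 s = trans (cong e (double+2 s)) (e-even (suc s))

e-odd+2 : ∀ s → e (suc (s + s) + 2) ≡ - (+ 1 +ℤ + s)
e-odd+2 s = trans (cong (e ∘ suc) (double+2 s)) (e-odd (suc s))

-- Windows of representatives

-- z is the representative of its class modulo 2[1+ g ] with -g ≤ z ≤ g + 1.
record Window (g : ℕ) (z : ℤ) : Set where
  constructor window
  field
    offset : ℕ
    offset<2[1+g] : offset < 2[1+ g ]
    z+g≡offset : z +ℤ + g ≡ + offset

window-unique : ∀ {g x y} → Window g x → Window g y → x ≡ y [mod 2[1+ g ] ] → x ≡ y
window-unique {g} {x} {y} (window u u< x+g≡u) (window v v< y+g≡v) x≡y = begin
  x                  ≡⟨ i+j-j≡i x (+ g) ⟨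
  x +ℤ + g -ℤ + g    ≡⟨ cong (_-ℤ + g) (trans x+g≡u (trans (cong +_ u≡v) (sym y+g≡v))) ⟩
  y +ℤ + g -ℤ + g    ≡⟨ i+j-j≡i y (+ g) ⟩
  y                  ∎
  where
  open ≡-Reasoning
  u≡v : u ≡ v
  u≡v = mod-unique u< v< (subst₂ _≡_[mod 2[1+ g ] ] x+g≡u y+g≡v (mod-+-cong x≡y (mod-refl {x = + g})))

window-exists : ∀ g z → ∃[ y ] Window g y × y ≡ z [mod 2[1+ g ] ]
window-exists g z = + u -ℤ + g , window u (n%ℕd<d (z +ℤ + g) 2[1+ g ]) (i-j+j≡i (+ u) (+ g)) ,
  subst (+ u -ℤ + g ≡_[mod 2[1+ g ] ]) (i+j-j≡i z (+ g))
        (mod-+-cong (mod-sym (mod-%ℕ (z +ℤ + g))) (mod-refl {x = - + g}))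
  where
  u = (z +ℤ + g) %ℕ 2[1+ g ]

window-suc : ∀ {g z} → Window g z → Window (suc g) z
window-suc {g} {z} (window u u< z+g≡u) =
  window (suc u) (s≤s (ℕ.≤-trans u< (s≤s (ℕ.+-monoʳ-≤ g (ℕ.n≤1+n (suc g))))))
                 (trans (regroup z (+ g)) (cong (+ 1 +ℤ_) z+g≡u))
  where
  regroup : ∀ a b → a +ℤ (+ 1 +ℤ b) ≡ + 1 +ℤ (a +ℤ b)
  regroup = solve-∀

+-∸ : ∀ {m n} → n ≤ m → + (m ∸ n) ≡ + m -ℤ + n
+-∸ {m} {n} n≤m = sym (trans (ℤ.m-n≡m⊖n m n) (ℤ.⊖-≥ n≤m))

difference-window : ∀ {g s t} → s ≤ suc g → t ≤ g → Window g (+ s -ℤ + t)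
difference-window {g} {s} {t} s≤g+1 t≤g = window (s + (g ∸ t)) u<2[1+g] (begin
  + s -ℤ + t +ℤ + g      ≡⟨ regroup (+ s) (+ t) (+ g) ⟩
  + s +ℤ (+ g -ℤ + t)    ≡⟨ cong (+ s +ℤ_) (+-∸ t≤g) ⟨
  + (s + (g ∸ t))        ∎)
  where
  open ≡-Reasoning
  regroup : ∀ a b c → a -ℤ b +ℤ c ≡ a +ℤ (c -ℤ b)
  regroup = solve-∀
  u<2[1+g] : s + (g ∸ t) < 2[1+ g ]
  u<2[1+g] = ℕ.≤-trans (s≤s (ℕ.+-mono-≤ s≤g+1 (ℕ.m∸n≤m g t)))
                       (ℕ.≤-reflexive (cong suc (ℕ.+-comm (suc g) g)))

e-window : ∀ {g v} → InRange 2[1+ g ] v → Window g (e v)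
e-window {g} {v} (1≤v , v≤n) with parity v
... | even zero = contradiction 1≤v λ ()
... | even (suc s) = subst (Window g) (trans (ℤ.+-identityʳ (+ suc s)) (sym (e-even (suc s))))
                            (difference-window (double-cancel-≤ v≤n) z≤n)
... | odd s = subst (Window g) (trans (ℤ.+-identityˡ (- + s)) (sym (e-odd s)))
                     (difference-window {t = s} z≤n (ℕ.≤-pred (odd-double-cancel-< v≤n)))

e-window⁻¹ : ∀ {g v} → 1 ≤ v → Window g (e v) → v ≤ 2[1+ g ]
e-window⁻¹ {g} {v} 1≤v (window u u<n e+g≡u) with parity v
... | even zero = contradiction 1≤v λ ()
... | even (suc s) = ℕ.+-mono-≤ s≤g s≤g
  where
  s+g≡u : suc s + g ≡ u
  s+g≡u = ℤ.+-injective (trans (ℤ.pos-+ (suc s) g) (trans (cong (_+ℤ + g) (sym (e-even (suc s)))) e+g≡u))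
  s≤g : suc s ≤ suc g
  s≤g = ℕ.+-cancelʳ-≤ g (suc s) (suc g)
          (ℕ.≤-trans (ℕ.≤-reflexive s+g≡u)
                     (ℕ.≤-pred (subst (u <_) (cong suc (ℕ.+-comm g (suc g))) u<n)))
... | odd s = s≤s (ℕ.+-mono-≤ s≤g (ℕ.≤-trans s≤g (ℕ.n≤1+n g)))
  where
  regroup : ∀ a b → a ≡ - b +ℤ a +ℤ b
  regroup = solve-∀
  g≡u+s : g ≡ u + s
  g≡u+s = ℤ.+-injective (begin
    + g                            ≡⟨ regroup (+ g) (+ s) ⟩
    - + s +ℤ + g +ℤ + s            ≡⟨ cong (λ x → x +ℤ + g +ℤ + s) (e-odd s) ⟨
    e (suc (s + s)) +ℤ + g +ℤ + s  ≡⟨ cong (_+ℤ + s) e+g≡u ⟩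
    + u +ℤ + s                     ≡⟨ ℤ.pos-+ u s ⟨
    + (u + s)                      ∎)
    where open ≡-Reasoning
  s≤g : s ≤ g
  s≤g = ℕ.≤-trans (ℕ.m≤n+m s u) (ℕ.≤-reflexive (sym g≡u+s))

module _ {g : ℕ} where

  e-injective-mod : ∀ {v w} → InRange 2[1+ g ] v → InRange 2[1+ g ] w →
                    e v ≡ e w [mod 2[1+ g ] ] → v ≡ w
  e-injective-mod v∈ w∈ p =
    e-injective (proj₁ v∈) (proj₁ w∈) (window-unique (e-window v∈) (e-window w∈) p)

  e-surjective-mod : ∀ z → ∃[ v ] InRange 2[1+ g ] v × e v ≡ z [mod 2[1+ g ] ]
  e-surjective-mod z with window-exists g z
  ... | y , y-window , y≡z =
    e⁻¹ y , (1≤e⁻¹ y , e-window⁻¹ (1≤e⁻¹ y) (subst (Window g) (sym (e∘e⁻¹ y)) y-window)) ,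
    subst (_≡ z [mod 2[1+ g ] ]) (sym (e∘e⁻¹ y)) y≡z

  e-window-exact : ∀ {v z} → InRange 2[1+ suc g ] v → e v ≡ z [mod 2[1+ suc g ] ] → Window g z →
                   InRange 2[1+ g ] v × e v ≡ z
  e-window-exact v∈ ev≡z z-window =
    (proj₁ v∈ , e-window⁻¹ (proj₁ v∈) (subst (Window g) (sym ev=z) z-window)) , ev=z
    where
    ev=z = window-unique (e-window v∈) (window-suc z-window) ev≡z

Δe-odd : ∀ s → Δ e (suc (s + s)) ≡ + suc (s + s)
Δe-odd s = begin
  e (suc (suc (s + s))) -ℤ e (suc (s + s)) ≡⟨ cong₂ _-ℤ_ e[2s+2]≡1+s (e-odd s) ⟩
  + 1 +ℤ + s -ℤ - + s                      ≡⟨ regroup (+ s) ⟩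
  + 1 +ℤ (+ s +ℤ + s)                      ∎
  where
  open ≡-Reasoning
  e[2s+2]≡1+s : e (suc (suc (s + s))) ≡ + 1 +ℤ + s
  e[2s+2]≡1+s = trans (cong (e ∘ suc) (sym (ℕ.+-suc s s))) (e-even (suc s))
  regroup : ∀ a → + 1 +ℤ a -ℤ - a ≡ + 1 +ℤ (a +ℤ a)
  regroup = solve-∀

Δe-even : ∀ s → Δ e (s + s) ≡ - + (s + s)
Δe-even s = begin
  e (suc (s + s)) -ℤ e (s + s) ≡⟨ cong₂ _-ℤ_ (e-odd s) (e-even s) ⟩
  - + s -ℤ + s                 ≡⟨ regroup (+ s) ⟩
  - (+ s +ℤ + s)               ∎
  where
  open ≡-Reasoning
  regroup : ∀ a → - a -ℤ a ≡ - (a +ℤ a)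
  regroup = solve-∀

module _ {g : ℕ} where

  private
    n = 2[1+ g ]

    odd+even≢n : ∀ s t → suc (s + s) + (t + t) ≢ n
    odd+even≢n s t eq = even≢odd (suc g) (s + t) (trans (sym eq) (regroup s t))
      where
      regroup : ∀ s t → suc (s + s) + (t + t) ≡ suc ((s + t) + (s + t))
      regroup = ℕ-Solver.solve-∀

    -- The residue of -k is n - k, which is even when k is.
    odd≢-even : ∀ s t → suc (s + s) < n → 1 ≤ t + t → t + t < n →
                ¬ + suc (s + s) ≡ - + (t + t) [mod n ]
    odd≢-even s t j<n 1≤k k<n p = odd+even≢n s t (begin
      suc (s + s) + (t + t)        ≡⟨ cong (_+ (t + t)) j≡n∸k ⟩
      n ∸ (t + t) + (t + t)        ≡⟨ ℕ.m∸n+n≡m (ℕ.<⇒≤ k<n) ⟩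
      n                            ∎)
      where
      open ≡-Reasoning
      j≡n∸k : suc (s + s) ≡ n ∸ (t + t)
      j≡n∸k = mod-unique j<n (ℕ.∸-monoʳ-< 1≤k (ℕ.<⇒≤ k<n))
                         (mod-trans p (mod-complement (ℕ.m+[n∸m]≡n (ℕ.<⇒≤ k<n))))

  Δe-injective : ∀ {j k} → InRange (n ∸ 1) j → InRange (n ∸ 1) k → Δ e j ≡ Δ e k [mod n ] → j ≡ k
  Δe-injective {j} {k} (1≤j , j≤) (1≤k , k≤) p with parity j | parity k
  ... | even s | even t = mod-unique (s≤s j≤) (s≤s k≤)
                            (subst₂ _≡_[mod n ] (ℤ.neg-involutive _) (ℤ.neg-involutive _)
                              (mod-neg-cong (subst₂ _≡_[mod n ] (Δe-even s) (Δe-even t) p)))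
  ... | odd s | odd t = mod-unique (s≤s j≤) (s≤s k≤) (subst₂ _≡_[mod n ] (Δe-odd s) (Δe-odd t) p)
  ... | odd s | even t =
    contradiction (subst₂ _≡_[mod n ] (Δe-odd s) (Δe-even t) p)
                  (odd≢-even s t (s≤s j≤) 1≤k (s≤s k≤))
  ... | even s | odd t =
    contradiction (subst₂ _≡_[mod n ] (Δe-odd t) (Δe-even s) (mod-sym p))
                  (odd≢-even t s (s≤s k≤) 1≤j (s≤s j≤))

  Δe-surjective : ∀ z → ¬ z ≡ 0ℤ [mod n ] → ∃[ j ] InRange (n ∸ 1) j × Δ e j ≡ z [mod n ]
  Δe-surjective z z≢0 = from-residue (parity (z %ℕ n)) (mod-%ℕ z) (n%ℕd<d z n)
    where
    from-residue : ∀ {r} → Parity r → z ≡ + r [mod n ] → r < n →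
                   ∃[ j ] InRange (n ∸ 1) j × Δ e j ≡ z [mod n ]
    from-residue (even zero) z≡0 _ = contradiction z≡0 z≢0
    from-residue (odd s) z≡r r<n =
      suc (s + s) , (s≤s z≤n , ℕ.≤-pred r<n) , mod-trans (mod-reflexive (Δe-odd s)) (mod-sym z≡r)
    from-residue (even (suc s)) z≡r r<n =
      d + d , (1≤d+d , ℕ.≤-pred d+d<n) ,
      mod-trans (mod-reflexive (Δe-even d)) (mod-trans (mod-complement d+d+r≡n) (mod-sym z≡r))
      where
      s<g : s < g
      s<g = ℕ.≤-pred (odd-double-cancel-< r<n)
      d = g ∸ s
      d+d+r≡n : d + d + (suc s + suc s) ≡ n
      d+d+r≡n = trans (regroup d s) (cong (λ x → suc x + suc x) (ℕ.m∸n+n≡m (ℕ.<⇒≤ s<g)))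
        where
        regroup : ∀ d s → d + d + (suc s + suc s) ≡ suc (d + s) + suc (d + s)
        regroup = ℕ-Solver.solve-∀
      1≤d+d : 1 ≤ d + d
      1≤d+d = ℕ.≤-trans (ℕ.m<n⇒0<n∸m s<g) (ℕ.m≤m+n d d)
      d+d<n : d + d < n
      d+d<n = subst (d + d <_) d+d+r≡n (ℕ.m<m+n (d + d) (s≤s z≤n))

  e-directedTerrace : IsDirectedTerrace n e
  e-directedTerrace = record
    { injective = e-injective-mod
    ; surjective = e-surjective-mod
    ; Δ-injective = Δe-injective
    ; Δ-surjective = Δe-surjective
    }

-- A_μ is the addition table of e

≡ᵇ-false : ∀ {m n} → m ≢ n → (m ≡ᵇ n) ≡ false
≡ᵇ-false {m} {n} m≢n with m ≡ᵇ n in eq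
... | true = contradiction (ℕ.≡ᵇ⇒≡ m n (subst T (sym eq) _)) m≢n
... | false = refl

≡ᵇ-refl : ∀ n → (n ≡ᵇ n) ≡ true
≡ᵇ-refl zero = refl
≡ᵇ-refl (suc n) = ≡ᵇ-refl n

fμ-last : ∀ g → fμ 2[1+ g ] 2[1+ g ] ≡ suc (g + g)
fμ-last g rewrite ≡ᵇ-false (even≢odd (suc g) 0) | ≡ᵇ-refl 2[1+ g ] = ℕ.+-suc g g

fμ-even : ∀ {n v} → v ≢ 1 → v ≢ n → v % 2 ≡ 0 → fμ n v ≡ v + 2
fμ-even v≢1 v≢n v%2≡0 rewrite ≡ᵇ-false v≢1 | ≡ᵇ-false v≢n | v%2≡0 = refl

fμ-odd : ∀ {n v} → v ≢ 1 → v ≢ n → v % 2 ≡ 1 → fμ n v ≡ v ∸ 2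
fμ-odd v≢1 v≢n v%2≡1 rewrite ≡ᵇ-false v≢1 | ≡ᵇ-false v≢n | v%2≡1 = refl

ShiftsBy : ℕ → (ℕ → ℤ) → (ℕ → ℕ) → ℤ → Set
ShiftsBy n ℓ φ c = ∀ {v} → InRange n v → InRange n (φ v) × ℓ (φ v) ≡ ℓ v +ℤ c [mod n ]

iter-shiftsBy : ∀ {n ℓ φ c} → ShiftsBy n ℓ φ c → ∀ t → ShiftsBy n ℓ (iter φ t) (+ t *ℤ c)
iter-shiftsBy {ℓ = ℓ} shift zero {v} v∈ = v∈ , mod-reflexive (sym (ℤ.+-identityʳ (ℓ v)))
iter-shiftsBy {ℓ = ℓ} {c = c} shift (suc t) {v} v∈ with iter-shiftsBy {ℓ = ℓ} {c = c} shift t v∈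
... | w∈ , ℓw≡ℓv+tc with shift w∈
... | φw∈ , ℓφw≡ℓw+c = φw∈ , mod-trans ℓφw≡ℓw+c
  (mod-trans (mod-+-cong ℓw≡ℓv+tc (mod-refl {x = c})) (mod-reflexive (regroup (ℓ v) (+ t) c)))
  where
  regroup : ∀ a t c → a +ℤ t *ℤ c +ℤ c ≡ a +ℤ (+ 1 +ℤ t) *ℤ c
  regroup = solve-∀

fμ-shifts : ∀ g → ShiftsBy 2[1+ g ] e (fμ 2[1+ g ]) (+ 1)
fμ-shifts g {v} (1≤v , v≤n) with v ℕ.≟ 2[1+ g ]
... | yes refl rewrite fμ-last g | e-odd g = (s≤s z≤n , s≤s (ℕ.+-monoʳ-≤ g (ℕ.n≤1+n g))) , wrap
  where
  wrap : - + g ≡ e 2[1+ g ] +ℤ + 1 [mod 2[1+ g ] ]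
  wrap = subst (- + g ≡_[mod 2[1+ g ] ]) (cong (_+ℤ + 1) (sym (e-even (suc g))))
           (mod-by-multiple (- + 1) (regroup (+ g)))
    where
    regroup : ∀ a → - a ≡ (+ 1 +ℤ a) +ℤ + 1 +ℤ - + 1 *ℤ ((+ 1 +ℤ a) +ℤ (+ 1 +ℤ a))
    regroup = solve-∀
... | no v≢n with parity v
...   | even zero = contradiction 1≤v λ ()
...   | even (suc s) =
  subst (InRange 2[1+ g ]) (sym fv≡v+2) (s≤s z≤n , ℕ.+-mono-≤ s+2≤g+1 s+2≤g+1) , mod-reflexive e-step
  where
  s+2≤g+1 : suc (suc s) ≤ suc g
  s+2≤g+1 = odd-double-cancel-< (ℕ.≤∧≢⇒< v≤n v≢n)
  fv≡v+2 : fμ 2[1+ g ] (suc s + suc s) ≡ suc (suc s) + suc (suc s)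
  fv≡v+2 = trans (fμ-even (even≢odd (suc s) 0) v≢n (double%2≡0 (suc s))) (double+2 (suc s))
  e-step : e (fμ 2[1+ g ] (suc s + suc s)) ≡ e (suc s + suc s) +ℤ + 1
  e-step = begin
    e (fμ 2[1+ g ] (suc s + suc s)) ≡⟨ cong e fv≡v+2 ⟩
    e (suc (suc s) + suc (suc s))   ≡⟨ e-even (suc (suc s)) ⟩
    + 1 +ℤ + suc s                  ≡⟨ ℤ.+-comm (+ 1) (+ suc s) ⟩
    + suc s +ℤ + 1                  ≡⟨ cong (_+ℤ + 1) (e-even (suc s)) ⟨
    e (suc s + suc s) +ℤ + 1        ∎
    where open ≡-Reasoning
...   | odd zero = (s≤s z≤n , s≤s (ℕ.≤-trans (s≤s z≤n) (ℕ.m≤n+m (suc g) g))) , mod-refl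
...   | odd (suc s) = subst (InRange 2[1+ g ]) (sym fv≡v∸2) (s≤s z≤n , v∸2≤n) , mod-reflexive e-step
  where
  fv≡v∸2 : fμ 2[1+ g ] (suc (suc s + suc s)) ≡ suc (s + s)
  fv≡v∸2 = trans (fμ-odd (ℕ.1+n≢0 ∘ ℕ.suc-injective) v≢n (odd%2≡1 (suc s))) (ℕ.+-suc s s)
  v∸2≤n : suc (s + s) ≤ 2[1+ g ]
  v∸2≤n = ℕ.≤-trans (ℕ.m≤n+m _ 2) (subst (_≤ 2[1+ g ]) (cong (λ x → 2 + x) (ℕ.+-suc s s)) v≤n)
  e-step : e (fμ 2[1+ g ] (suc (suc s + suc s))) ≡ e (suc (suc s + suc s)) +ℤ + 1
  e-step = begin
    e (fμ 2[1+ g ] (suc (suc s + suc s))) ≡⟨ cong e fv≡v∸2 ⟩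
    e (suc (s + s))                       ≡⟨ e-odd s ⟩
    - + s                                 ≡⟨ regroup (+ s) ⟩
    - + suc s +ℤ + 1                      ≡⟨ cong (_+ℤ + 1) (e-odd (suc s)) ⟨
    e (suc (suc s + suc s)) +ℤ + 1        ∎
    where
    open ≡-Reasoning
    regroup : ∀ a → - a ≡ - (+ 1 +ℤ a) +ℤ + 1
    regroup = solve-∀

search-correct : ∀ (φ : ℕ → ℕ) {x k} K → InRange K k → φ k ≡ x →
                 InRange K (search φ x K) × φ (search φ x K) ≡ x
search-correct φ zero (1≤k , k≤0) _ = contradiction (ℕ.≤-trans 1≤k k≤0) λ ()
search-correct φ {x} {k} (suc K) (1≤k , k≤K+1) φk≡x with φ (suc K) ≡ᵇ x in eq
... | true = (s≤s z≤n , ℕ.≤-refl) , ℕ.≡ᵇ⇒≡ _ _ (subst T (sym eq) _)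
... | false with k ℕ.≟ suc K
...   | yes refl = contradiction (ℕ.≡⇒≡ᵇ _ _ φk≡x) (subst T eq)
...   | no k≢K+1 with search-correct φ K (1≤k , ℕ.≤-pred (ℕ.≤∧≢⇒< k≤K+1 k≢K+1)) φk≡x
...     | (1≤w , w≤K) , φw≡x = (1≤w , ℕ.≤-trans w≤K (ℕ.n≤1+n K)) , φw≡x

fμ⁻¹-shifts : ∀ g → ShiftsBy 2[1+ g ] e (fμ⁻¹ 2[1+ g ]) (- + 1)
fμ⁻¹-shifts g {v} v∈ = proj₁ found , ew≡ev-1
  where
  n = 2[1+ g ]
  preimage : ∃[ k ] InRange n k × fμ n k ≡ v
  preimage with e-surjective-mod (e v -ℤ + 1)
  ... | k , k∈ , ek≡ev-1 = k , k∈ , e-injective-mod (proj₁ (fμ-shifts g k∈)) v∈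
    (mod-trans (proj₂ (fμ-shifts g k∈))
               (subst (_ ≡_[mod n ]) (i-j+j≡i (e v) (+ 1)) (mod-+-cong ek≡ev-1 (mod-refl {x = + 1}))))
  found : InRange n (fμ⁻¹ n v) × fμ n (fμ⁻¹ n v) ≡ v
  found = search-correct (fμ n) n (proj₁ (proj₂ preimage)) (proj₂ (proj₂ preimage))
  w = fμ⁻¹ n v
  ew≡ev-1 : e w ≡ e v +ℤ - + 1 [mod n ]
  ew≡ev-1 = subst (_≡ e v +ℤ - + 1 [mod n ]) (i+j-j≡i (e w) (+ 1))
    (mod-+-cong (mod-trans (mod-sym (proj₂ (fμ-shifts g (proj₁ found))))
                           (mod-reflexive (cong e (proj₂ found))))
                (mod-refl {x = - + 1}))

Aμ-additionTable : ∀ g → IsAdditionTable 2[1+ g ] e (Aμ 2[1+ g ])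
Aμ-additionTable g {i} {j} i∈ j∈ with i % 2 ≡ᵇ 0
... | true = map₂ (λ p → mod-trans p (mod-reflexive (swap (e j) (+ (i / 2)))))
                  (iter-shiftsBy {ℓ = e} (fμ-shifts g) (i / 2) j∈)
  where
  swap : ∀ a t → a +ℤ t *ℤ + 1 ≡ t +ℤ a
  swap = solve-∀
... | false = map₂ (λ p → mod-trans p (mod-reflexive (swap (e j) (+ (i / 2)))))
                   (iter-shiftsBy {ℓ = e} (fμ⁻¹-shifts g) (i / 2) j∈)
  where
  swap : ∀ a t → a +ℤ t *ℤ - + 1 ≡ - t +ℤ a
  swap = solve-∀

-- R_μ(A_μ) is the addition table of e modulo n - 2

Rμ-upper : ∀ {n i j} → i + j ≤ n ∸ 2 + 1 → Rμ n i j ≡ Aμ n i j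
Rμ-upper {n} {i} {j} i+j≤ with i + j ≤ᵇ n ∸ 2 + 1 | ℕ.≤⇒≤ᵇ i+j≤
... | true | _ = refl

Rμ-lower : ∀ {n i j} → ¬ i + j ≤ n ∸ 2 + 1 → Rμ n i j ≡ Aμ n (i + 2) (j + 2)
Rμ-lower {n} {i} {j} i+j≰ with i + j ≤ᵇ n ∸ 2 + 1 in side
... | true = contradiction (ℕ.≤ᵇ⇒≤ (i + j) (n ∸ 2 + 1) (subst T (sym side) _)) i+j≰
... | false = refl

module _ {g : ℕ} where

  private
    m = 2[1+ g ]
    N = 2[1+ suc g ]

  even-bounds : ∀ {s} → InRange m (s + s) → 1 ≤ s × s ≤ suc g
  even-bounds {zero} (() , _)
  even-bounds {suc s} (_ , s+s≤m) = s≤s z≤n , double-cancel-≤ s+s≤m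

  odd-bound : ∀ {s} → InRange m (suc (s + s)) → s ≤ g
  odd-bound (_ , j≤m) = ℕ.≤-pred (odd-double-cancel-< j≤m)

  upper-window : ∀ {i j} → Parity i → Parity j → InRange m i → InRange m j → i + j ≤ suc m →
                 Window g (e i +ℤ e j)
  upper-window (even s) (even t) _ _ i+j≤m+1 =
    subst (Window g) (sym (cong₂ _+ℤ_ (e-even s) (e-even t))) (window (s + t + g) u<m refl)
    where
    s+t≤g+1 : s + t ≤ suc g
    s+t≤g+1 = double-odd-cancel-≤ (subst (_≤ suc m) (interchange s t) i+j≤m+1)
    u<m : s + t + g < m
    u<m = s≤s (ℕ.≤-trans (ℕ.+-monoˡ-≤ g s+t≤g+1) (ℕ.≤-reflexive (ℕ.+-comm (suc g) g)))
  upper-window (even s) (odd t) i∈ j∈ _ =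
    subst (Window g) (sym (cong₂ _+ℤ_ (e-even s) (e-odd t)))
          (difference-window (proj₂ (even-bounds {s} i∈)) (odd-bound {t} j∈))
  upper-window (odd s) (even t) i∈ j∈ _ =
    subst (Window g) (sym (trans (cong₂ _+ℤ_ (e-odd s) (e-even t)) (ℤ.+-comm (- + s) (+ t))))
          (difference-window (proj₂ (even-bounds {t} j∈)) (odd-bound {s} i∈))
  upper-window (odd s) (odd t) _ _ i+j≤m+1 =
    subst (Window g) (sym (cong₂ _+ℤ_ (e-odd s) (e-odd t)))
          (window (g ∸ (s + t)) (s≤s (ℕ.≤-trans (ℕ.m∸n≤m g (s + t)) (ℕ.m≤m+n g (suc g)))) e+g≡u)
    where
    s+t≤g : s + t ≤ g
    s+t≤g = ℕ.≤-pred (odd-double-cancel-< (ℕ.≤-pred (subst (_≤ suc m) (interchange-odd s t) i+j≤m+1)))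
    regroup : ∀ a b c → - a +ℤ - b +ℤ c ≡ c -ℤ (a +ℤ b)
    regroup = solve-∀
    e+g≡u : - + s +ℤ - + t +ℤ + g ≡ + (g ∸ (s + t))
    e+g≡u = trans (regroup (+ s) (+ t) (+ g)) (sym (+-∸ s+t≤g))

  lower-window : ∀ {i j} → Parity i → Parity j → InRange m i → InRange m j → suc (suc m) ≤ i + j →
                 ∃[ z ] Window g z × e (i + 2) +ℤ e (j + 2) ≡ z [mod N ] × z ≡ e i +ℤ e j [mod m ]
  lower-window (even s) (even t) i∈ j∈ m+2≤i+j =
    + w -ℤ + g , window w w<m (i-j+j≡i (+ w) (+ g)) ,
    subst (_≡ + w -ℤ + g [mod N ]) (sym (cong₂ _+ℤ_ (e-even+2 s) (e-even+2 t)))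
          (mod-by-multiple (+ 1) (wrap-down (+ s) (+ t) (+ w) (+ g) s+t≡w+2+g)) ,
    subst (+ w -ℤ + g ≡_[mod m ]) (sym (cong₂ _+ℤ_ (e-even s) (e-even t)))
          (mod-by-multiple (- + 1) (shift-down (+ s) (+ t) (+ w) (+ g) s+t≡w+2+g))
    where
    g+2≤s+t : suc (suc g) ≤ s + t
    g+2≤s+t = double-cancel-≤
      (subst₂ _≤_ (trans (ℕ.+-comm 2 m) (2[1+g]+2≡2[2+g] g)) (interchange s t) m+2≤i+j)
    w = s + t ∸ suc (suc g)
    w+g+2≡s+t : w + suc (suc g) ≡ s + t
    w+g+2≡s+t = ℕ.m∸n+n≡m g+2≤s+t
    s+t≡w+2+g : + s +ℤ + t ≡ + w +ℤ + 2 +ℤ + g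
    s+t≡w+2+g = cong +_ (sym (trans (ℕ.+-assoc w 2 g) w+g+2≡s+t))
    w<m : w < m
    w<m = s≤s (ℕ.≤-trans w≤g (ℕ.m≤m+n g (suc g)))
      where
      w≤g : w ≤ g
      w≤g = ℕ.+-cancelʳ-≤ (suc (suc g)) w g
              (subst₂ _≤_ (sym w+g+2≡s+t) (sym (ℕ.+-suc g (suc g)))
                      (ℕ.+-mono-≤ (proj₂ (even-bounds {s} i∈)) (proj₂ (even-bounds {t} j∈))))
    wrap-down : ∀ a b w h → a +ℤ b ≡ w +ℤ + 2 +ℤ h →
                + 1 +ℤ a +ℤ (+ 1 +ℤ b) ≡ w -ℤ h +ℤ + 1 *ℤ (+ 2 +ℤ h +ℤ (+ 2 +ℤ h))
    wrap-down a b w h eq = begin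
      + 1 +ℤ a +ℤ (+ 1 +ℤ b)                        ≡⟨ solve (a ∷ b ∷ []) ⟩
      + 2 +ℤ (a +ℤ b)                               ≡⟨ cong (+ 2 +ℤ_) eq ⟩
      + 2 +ℤ (w +ℤ + 2 +ℤ h)                        ≡⟨ solve (w ∷ h ∷ []) ⟩
      w -ℤ h +ℤ + 1 *ℤ (+ 2 +ℤ h +ℤ (+ 2 +ℤ h))    ∎
      where open ≡-Reasoning
    shift-down : ∀ a b w h → a +ℤ b ≡ w +ℤ + 2 +ℤ h →
                 w -ℤ h ≡ a +ℤ b +ℤ - + 1 *ℤ (+ 1 +ℤ h +ℤ (+ 1 +ℤ h))
    shift-down a b w h eq = begin
      w -ℤ h                                              ≡⟨ solve (w ∷ h ∷ []) ⟩
      w +ℤ + 2 +ℤ h +ℤ - + 1 *ℤ (+ 1 +ℤ h +ℤ (+ 1 +ℤ h))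
        ≡⟨ cong (_+ℤ - + 1 *ℤ (+ 1 +ℤ h +ℤ (+ 1 +ℤ h))) eq ⟨
      a +ℤ b +ℤ - + 1 *ℤ (+ 1 +ℤ h +ℤ (+ 1 +ℤ h))        ∎
      where open ≡-Reasoning
  lower-window (even s) (odd t) i∈ j∈ _ =
    + s -ℤ + t , difference-window (proj₂ (even-bounds {s} i∈)) (odd-bound {t} j∈) ,
    mod-reflexive (trans (cong₂ _+ℤ_ (e-even+2 s) (e-odd+2 t)) (cancel (+ s) (+ t))) ,
    mod-reflexive (sym (cong₂ _+ℤ_ (e-even s) (e-odd t)))
    where
    cancel : ∀ a b → + 1 +ℤ a +ℤ - (+ 1 +ℤ b) ≡ a -ℤ b
    cancel = solve-∀
  lower-window (odd s) (even t) i∈ j∈ _ =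
    + t -ℤ + s , difference-window (proj₂ (even-bounds {t} j∈)) (odd-bound {s} i∈) ,
    mod-reflexive (trans (cong₂ _+ℤ_ (e-odd+2 s) (e-even+2 t)) (cancel (+ s) (+ t))) ,
    mod-reflexive (sym (trans (cong₂ _+ℤ_ (e-odd s) (e-even t)) (ℤ.+-comm (- + s) (+ t))))
    where
    cancel : ∀ a b → - (+ 1 +ℤ a) +ℤ (+ 1 +ℤ b) ≡ b -ℤ a
    cancel = solve-∀
  lower-window (odd s) (odd t) i∈ j∈ m+2≤i+j =
    + suc g -ℤ + w , difference-window ℕ.≤-refl w≤g ,
    subst (_≡ + suc g -ℤ + w [mod N ]) (sym (cong₂ _+ℤ_ (e-odd+2 s) (e-odd+2 t)))
          (mod-by-multiple (- + 1) (wrap-up (+ s) (+ t) (+ w) (+ g) s+t≡w+1+g)) ,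
    subst (+ suc g -ℤ + w ≡_[mod m ]) (sym (cong₂ _+ℤ_ (e-odd s) (e-odd t)))
          (mod-by-multiple (+ 1) (shift-up (+ s) (+ t) (+ w) (+ g) s+t≡w+1+g))
    where
    g+1≤s+t : suc g ≤ s + t
    g+1≤s+t = double-cancel-≤
      (ℕ.≤-pred (ℕ.≤-pred (subst (suc (suc m) ≤_) (interchange-odd s t) m+2≤i+j)))
    w = s + t ∸ suc g
    w+g+1≡s+t : w + suc g ≡ s + t
    w+g+1≡s+t = ℕ.m∸n+n≡m g+1≤s+t
    s+t≡w+1+g : + s +ℤ + t ≡ + w +ℤ + 1 +ℤ + g
    s+t≡w+1+g = cong +_ (sym (trans (ℕ.+-assoc w 1 g) w+g+1≡s+t))
    w≤g : w ≤ g
    w≤g = ℕ.+-cancelʳ-≤ (suc g) w g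
            (subst (_≤ g + suc g) (sym w+g+1≡s+t)
                   (ℕ.+-mono-≤ (odd-bound {s} i∈) (ℕ.≤-trans (odd-bound {t} j∈) (ℕ.n≤1+n g))))
    wrap-up : ∀ a b w h → a +ℤ b ≡ w +ℤ + 1 +ℤ h →
              - (+ 1 +ℤ a) +ℤ - (+ 1 +ℤ b) ≡ + 1 +ℤ h -ℤ w +ℤ - + 1 *ℤ (+ 2 +ℤ h +ℤ (+ 2 +ℤ h))
    wrap-up a b w h eq = begin
      - (+ 1 +ℤ a) +ℤ - (+ 1 +ℤ b)                         ≡⟨ solve (a ∷ b ∷ []) ⟩
      - + 2 -ℤ (a +ℤ b)                                    ≡⟨ cong (λ x → - + 2 -ℤ x) eq ⟩
      - + 2 -ℤ (w +ℤ + 1 +ℤ h)                             ≡⟨ solve (w ∷ h ∷ []) ⟩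
      + 1 +ℤ h -ℤ w +ℤ - + 1 *ℤ (+ 2 +ℤ h +ℤ (+ 2 +ℤ h))  ∎
      where open ≡-Reasoning
    shift-up : ∀ a b w h → a +ℤ b ≡ w +ℤ + 1 +ℤ h →
               + 1 +ℤ h -ℤ w ≡ - a +ℤ - b +ℤ + 1 *ℤ (+ 1 +ℤ h +ℤ (+ 1 +ℤ h))
    shift-up a b w h eq = begin
      + 1 +ℤ h -ℤ w                                         ≡⟨ solve (w ∷ h ∷ []) ⟩
      - (w +ℤ + 1 +ℤ h) +ℤ + 1 *ℤ (+ 1 +ℤ h +ℤ (+ 1 +ℤ h))
        ≡⟨ cong (λ x → - x +ℤ + 1 *ℤ (+ 1 +ℤ h +ℤ (+ 1 +ℤ h))) eq ⟨
      - (a +ℤ b) +ℤ + 1 *ℤ (+ 1 +ℤ h +ℤ (+ 1 +ℤ h))        ≡⟨ solve (a ∷ b ∷ h ∷ []) ⟩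
      - a +ℤ - b +ℤ + 1 *ℤ (+ 1 +ℤ h +ℤ (+ 1 +ℤ h))        ∎
      where open ≡-Reasoning

  Rμ-additionTable : IsAdditionTable m e (Rμ N)
  Rμ-additionTable {i} {j} i∈ j∈ = by-triangle (i + j ℕ.≤? suc m)
    where
    Entry : ℕ → Set
    Entry R = InRange m R × e R ≡ e i +ℤ e j [mod m ]
    upper-entry : i + j ≤ suc m → Entry (Aμ N i j)
    upper-entry i+j≤m+1 = map₂ mod-reflexive
      (e-window-exact (proj₁ entry) (proj₂ entry) (upper-window (parity i) (parity j) i∈ j∈ i+j≤m+1))
      where
      m≤N : m ≤ N
      m≤N = ℕ.+-mono-≤ (ℕ.n≤1+n (suc g)) (ℕ.n≤1+n (suc g))
      ∈N : ∀ {k} → InRange m k → InRange N k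
      ∈N (1≤k , k≤m) = 1≤k , ℕ.≤-trans k≤m m≤N
      entry = Aμ-additionTable (suc g) (∈N i∈) (∈N j∈)
    lower-entry : suc (suc m) ≤ i + j → Entry (Aμ N (i + 2) (j + 2))
    lower-entry m+2≤i+j with lower-window (parity i) (parity j) i∈ j∈ m+2≤i+j
    ... | z , z-window , sum≡z , z≡e[i]+e[j] =
      map₂ (λ eR≡z → mod-trans (mod-reflexive eR≡z) z≡e[i]+e[j])
           (e-window-exact (proj₁ entry) (mod-trans (proj₂ entry) sum≡z) z-window)
      where
      +2∈ : ∀ {k} → InRange m k → InRange N (k + 2)
      +2∈ {k} (1≤k , k≤m) =
        ℕ.≤-trans 1≤k (ℕ.m≤m+n k 2) , subst (k + 2 ≤_) (2[1+g]+2≡2[2+g] g) (ℕ.+-monoˡ-≤ 2 k≤m)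
      entry = Aμ-additionTable (suc g) (+2∈ i∈) (+2∈ j∈)
    by-triangle : Dec (i + j ≤ suc m) → Entry (Rμ N i j)
    by-triangle (yes i+j≤m+1) =
      subst Entry (sym (Rμ-upper {N} {i} {j} (subst (i + j ≤_) (sym (2[2+g]∸2+1≡2[1+g]+1 g)) i+j≤m+1)))
            (upper-entry i+j≤m+1)
    by-triangle (no i+j≰m+1) =
      subst Entry (sym (Rμ-lower {N} {i} {j} (i+j≰m+1 ∘ subst (i + j ≤_) (2[2+g]∸2+1≡2[1+g]+1 g))))
            (lower-entry (ℕ.≰⇒> i+j≰m+1))

even≥4 : ∀ {n} → 4 ≤ n → 2 ∣ n → ∃[ g ] n ≡ 2[1+ suc g ]
even≥4 4≤n (ℕ.divides zero refl) = contradiction 4≤n λ ()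
even≥4 4≤n (ℕ.divides (suc zero) refl) = contradiction 4≤n λ { (s≤s (s≤s ())) }
even≥4 4≤n (ℕ.divides (suc (suc g)) n≡) = g , trans n≡ (sym (double≡*2 (suc (suc g))))

theorem2 : ∀ (n : ℕ) → 4 ≤ n → 2 ∣ n →
    Harmonic (n ∸ 2) (Rμ n) × Isomorphic (n ∸ 2) (Rμ n) (Aμ (n ∸ 2))
theorem2 n 4≤n 2∣n with even≥4 4≤n 2∣n
... | g , refl =
  subst (λ m → Harmonic m (Rμ 2[1+ suc g ]) × Isomorphic m (Rμ 2[1+ suc g ]) (Aμ m))
        (sym (ℕ.+-suc g (suc g)))
    ( additionTable-harmonic e-directedTerrace Rμ-additionTable
    , agreeing-isomorphic (additionTables-agree e-directedTerrace (Aμ-additionTable g) Rμ-additionTable)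
    )
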